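{- Let $H$ be a simple hypergraph with no isolated vertices. Then $|V(H)|-|E(H)|\leq b_L(H)<b(H)\leq \alpha(H)+1$.
   Context: A hypergraph $H$ consists of a nonempty finite vertex set $V(H)$ and a finite family $E(H)$ of edges, each a subset of $V(H)$. $H$ is simple if no two distinct edges have the same vertex set and every edge contains at least two vertices. A vertex is isolated if it belongs to no edge. A set $X\subseteq V(H)$ is independent if no edge $e$ satisfies $e\subseteq X$; $\alpha(H)$ is the maximum size of an independent set. Round-based burning: let $F_0=\emptyset$. In each round $r=1,2,\ldots$ simultaneously: every vertex $v\notin F_{r-1}$ for which there is an edge $e$ with $|e|\geq 2$, $v\in e$ and $e\setminus\{v\}\subseteq F_{r-1}$ catches fire; and a chosen vertex $u_r\notin F_{r-1}$ (a source) is set on fire. $F_r$ is $F_{r-1}$ together with all vertices set on fire in round $r$. A sequence $(u_1,\ldots,u_k)$ with $u_r\notin F_{r-1}$ for all $r$ and $F_k=V(H)$ is a burning sequence; $b(H)$ is the minimum length of a burning sequence. Lazy burning: a set $S\subseteq V(H)$ is set on fire; then repeatedly any unburned vertex $v$ lying in an edge $e$ with $|e|\geq 2$ such that all vertices of $e\setminus\{v\}$ are on fire catches fire; $S$ is a lazy burning set if eventually all vertices are on fire; $b_L(H)$ is the minimum size of a lazy burning set. -}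

module Defs where

open import Data.Nat using (ℕ; _≤_; _<_; _∸_; _+_)
open import Data.Fin using (Fin)
open import Data.Fin.Subset using (Subset; _∈_; _⊆_; ∣_∣)
open import Data.List using (List; []; _∷_; length)
open import Data.List.Relation.Unary.Unique.Propositional using (Unique)
import Data.List.Membership.Propositional as LM
open import Data.Product using (Σ; _×_; ∃)
open import Data.Sum using (_⊎_)
open import Data.Empty using (⊥)
open import Data.Unit using (⊤)
open import Relation.Nullary using (¬_)
open import Relation.Binary.PropositionalEquality using (_≡_; _≢_)

_∈ₑ_ : ∀ {n} → Subset n → List (Subset n) → Set
e ∈ₑ E = e LM.∈ E

record Hypergraph : Set where
  field
    n        : ℕ
    nonempty : 0 < n
    edges    : List (Subset n)
open Hypergraph public

numV : Hypergraph → ℕ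
numV H = n H

numE : Hypergraph → ℕ
numE H = length (edges H)

IsSimple : Hypergraph → Set
IsSimple H = Unique (edges H) × (∀ e → e ∈ₑ edges H → 2 ≤ ∣ e ∣)

NoIsolated : Hypergraph → Set
NoIsolated H = ∀ (v : Fin (n H)) → Σ (Subset (n H)) λ e → e ∈ₑ edges H × v ∈ e

FireSet : ℕ → Set₁
FireSet k = Fin k → Set

Spreads : (H : Hypergraph) → FireSet (n H) → Fin (n H) → Set
Spreads H F v = Σ (Subset (n H)) λ e →
  e ∈ₑ edges H × v ∈ e × 2 ≤ ∣ e ∣ × (∀ w → w ∈ e → w ≢ v → F w)

step : (H : Hypergraph) → FireSet (n H) → Fin (n H) → FireSet (n H)
step H F u v = F v ⊎ Spreads H F v ⊎ v ≡ u

run : (H : Hypergraph) → FireSet (n H) → List (Fin (n H)) → FireSet (n H)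
run H F []       = F
run H F (u ∷ us) = run H (step H F u) us

ValidSources : (H : Hypergraph) → FireSet (n H) → List (Fin (n H)) → Set
ValidSources H F []       = ⊤
ValidSources H F (u ∷ us) = ¬ F u × ValidSources H (step H F u) us

emptyFire : ∀ {k} → FireSet k
emptyFire _ = ⊥

IsBurningSequence : (H : Hypergraph) → List (Fin (n H)) → Set
IsBurningSequence H us =
  ValidSources H emptyFire us × (∀ v → run H emptyFire us v)

IsBurningNumber : Hypergraph → ℕ → Set
IsBurningNumber H k =
  (Σ (List (Fin (n H))) λ us → IsBurningSequence H us × length us ≡ k)
  × (∀ us → IsBurningSequence H us → k ≤ length us)

data LazyBurnt (H : Hypergraph) (S : Subset (n H)) : Fin (n H) → Set where
  source : ∀ {v} → v ∈ S → LazyBurnt H S v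
  spread : ∀ {v} (e : Subset (n H)) → e ∈ₑ edges H → v ∈ e → 2 ≤ ∣ e ∣ →
           (∀ w → w ∈ e → w ≢ v → LazyBurnt H S w) → LazyBurnt H S v

IsLazyBurningSet : (H : Hypergraph) → Subset (n H) → Set
IsLazyBurningSet H S = ∀ v → LazyBurnt H S v

IsLazyBurningNumber : Hypergraph → ℕ → Set
IsLazyBurningNumber H k =
  (Σ (Subset (n H)) λ S → IsLazyBurningSet H S × ∣ S ∣ ≡ k)
  × (∀ S → IsLazyBurningSet H S → k ≤ ∣ S ∣)

IsIndependent : (H : Hypergraph) → Subset (n H) → Set
IsIndependent H X = ∀ e → e ∈ₑ edges H → ¬ (e ⊆ X)

IsIndependenceNumber : Hypergraph → ℕ → Set
IsIndependenceNumber H k =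
  (Σ (Subset (n H)) λ X → IsIndependent H X × ∣ X ∣ ≡ k)
  × (∀ X → IsIndependent H X → ∣ X ∣ ≤ k)

-- Lower bound: start from a lazy burning set S and let the fire spread one vertex at a time.
-- A vertex v catches fire through an edge e whose other vertices are already burning, so e
-- becomes entirely burnt exactly when v is added; hence every burnt set C reached from S
-- satisfies |C| ≤ |S| + #{edges inside C} ≤ |S| + |E|.
-- Middle: if (u₁, …, u_k) is a burning sequence, every vertex other than u_k is lazily burnt
-- from {u₁, …, u_{k-1}}, and then so is u_k through any edge containing it.
-- Upper bound: burn greedily, choosing as source a vertex that is neither burning nor about to
-- catch fire; an edge inside the chosen sources would have set the last of them on fire, so they
-- form an independent set. When no such vertex is left, one final source finishes the burning.
-- The three numbers exist because every property involved is decidable (lazy burning through the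
-- spreading closure above), so the extrema can be found by exhaustive search.
module Submission where

open import Defs
open import Data.Nat using (ℕ; _≤_; _<_; _∸_; _+_; zero; suc; z≤n; s≤s; z<s; _≟_; _≤?_)
open import Data.Nat.Properties
  using (≤-refl; ≤-reflexive; ≤-trans; <-≤-trans; <⇒≱; n≤1+n; m≤m+n; m<m+n; n≤0⇒n≡0;
         ≤∧≢⇒<; m<1+n⇒m≤n; m≤n+o⇒m∸n≤o; +-suc; +-comm; +-monoʳ-≤; +-monoˡ-≤; module ≤-Reasoning)
open import Data.Fin using (Fin; zero; suc; fromℕ<)
import Data.Fin.Properties as Fin
open import Data.Vec using ([]; _∷_)
open import Data.Fin.Subset using (Subset; _∈_; _∉_; _⊆_; ∣_∣; ⁅_⁆; _∪_; inside; outside)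
import Data.Fin.Subset as Subset
open import Data.Fin.Subset.Properties
  using (_∈?_; _⊆?_; anySubset?; x∈⁅x⁆; x∈⁅y⁆⇒x≡y; p⊆p∪q; q⊆p∪q; x∈p∪q⁻; ∪-identityʳ; p⊂q⇒∣p∣<∣q∣;
         p⊆q⇒∣p∣≤∣q∣; ∣p∣≤n; ∈⊤; ∉⊥; ∣⊤∣≡n; ∣⊥∣≡0)
open import Data.List using (List; []; _∷_; length; filter; _∷ʳ_; initLast; _∷ʳ′_)
open import Data.List.Properties using (length-filter; length-++)
open import Data.List.Relation.Unary.Any using (here; there; any?)
import Data.List.Relation.Unary.All as All
open import Data.List.Relation.Binary.Sublist.Propositional using (⊆-refl)
open import Data.List.Relation.Binary.Sublist.Propositional.Properties using (filter⁺; length-mono-≤)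
open import Data.List.Membership.Propositional using (find; lose) renaming (_∈_ to _∈ₗ_)
open import Data.Product using (Σ; _×_; _,_; proj₂)
open import Data.Sum using (_⊎_; inj₁; inj₂)
import Data.Sum as Sum
open import Data.Unit using (tt)
open import Function using (_∘_; id; case_of_)
open import Relation.Nullary using (¬_; Dec; yes; no; contradiction)
open import Relation.Nullary.Decidable using (_×-dec_; _⊎-dec_; _→-dec_; ¬?; map′; decidable-stable)
open import Relation.Unary using (Decidable)
open import Relation.Binary.PropositionalEquality using (_≡_; _≢_; refl; sym; cong; subst)

Attains : {A : Set} → (A → Set) → (A → ℕ) → ℕ → Set
Attains {A} P size k = Σ A λ x → P x × size x ≡ k

Least : {A : Set} → (A → Set) → (A → ℕ) → ℕ → Set
Least P size k = Attains P size k × (∀ x → P x → k ≤ size x)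

Greatest : {A : Set} → (A → Set) → (A → ℕ) → ℕ → Set
Greatest P size k = Attains P size k × (∀ x → P x → size x ≤ k)

least : {Q : ℕ → Set} → Decidable Q → ∀ k → Q k → Σ ℕ λ m → Q m × (∀ j → Q j → m ≤ j)
least Q? k q with Q? 0
... | yes q₀ = 0 , q₀ , λ _ _ → z≤n
least Q? zero q    | no ¬q₀ = contradiction q ¬q₀
least Q? (suc k) q | no ¬q₀ with least (Q? ∘ suc) k q
... | m , qm , minimal = suc m , qm , λ { zero q₀ → contradiction q₀ ¬q₀ ; (suc j) qj → s≤s (minimal j qj) }

greatest : {Q : ℕ → Set} → Decidable Q → ∀ b → (∀ j → Q j → j ≤ b) → ∀ k → Q k →
           Σ ℕ λ m → Q m × (∀ j → Q j → j ≤ m)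
greatest Q? b bounded k q with Q? b
... | yes q-b = b , q-b , bounded
greatest {Q} Q? zero bounded k q    | no ¬q₀ = contradiction (subst Q (n≤0⇒n≡0 (bounded k q)) q) ¬q₀
greatest {Q} Q? (suc b) bounded k q | no ¬q-b = greatest Q? b bounded′ k q
  where
  bounded′ : ∀ j → Q j → j ≤ b
  bounded′ j qj = m<1+n⇒m≤n (≤∧≢⇒< (bounded j qj) λ { refl → ¬q-b qj })

least-exists : {A : Set} {P : A → Set} {size : A → ℕ} →
               Decidable (Attains P size) → ∀ x → P x → Σ ℕ (Least P size)
least-exists {size = size} attains? x px with least attains? (size x) (x , px , refl)
... | m , attained , minimal = m , attained , λ y py → minimal (size y) (y , py , refl)

greatest-exists : {A : Set} {P : A → Set} {size : A → ℕ} →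
                  Decidable (Attains P size) → ∀ b → (∀ x → P x → size x ≤ b) →
                  ∀ x → P x → Σ ℕ (Greatest P size)
greatest-exists {size = size} attains? b bounded x px
  with greatest attains? b (λ { _ (y , py , refl) → bounded y py }) (size x) (x , px , refl)
... | m , attained , maximal = m , attained , λ y py → maximal (size y) (y , py , refl)

∃-∈? : {A : Set} {P : A → Set} → Decidable P → ∀ xs → Dec (Σ A λ x → x ∈ₗ xs × P x)
∃-∈? P? xs = map′ find (λ (_ , x∈xs , px) → lose x∈xs px) (any? P? xs)

∃-ofLength? : ∀ {k} {P : List (Fin k) → Set} → Decidable P → Decidable (Attains P length)
∃-ofLength? P? zero = map′ (λ p → [] , p , refl) (λ { ([] , p , _) → p ; (_ ∷ _ , _ , ()) }) (P? [])
∃-ofLength? P? (suc m) =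
  map′ (λ (x , xs , p , eq) → x ∷ xs , p , cong suc eq)
       (λ { ([] , _ , ()) ; (x ∷ xs , p , refl) → x , xs , p , refl })
       (Fin.any? λ x → ∃-ofLength? (P? ∘ (x ∷_)) m)

module _ {A : Set} {P Q : A → Set} (P? : Decidable P) (Q? : Decidable Q) (P⇒Q : ∀ {x} → P x → Q x) where

  length-filter-mono : ∀ xs → length (filter P? xs) ≤ length (filter Q? xs)
  length-filter-mono xs = length-mono-≤ (filter⁺ P? Q? (λ { refl → P⇒Q }) (⊆-refl {x = xs}))

  length-filter-< : ∀ {x xs} → x ∈ₗ xs → Q x → ¬ P x → length (filter P? xs) < length (filter Q? xs)
  length-filter-< {xs = x ∷ xs} (here refl) qx ¬px with P? x | Q? x
  ... | yes px | _      = contradiction px ¬px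
  ... | no _   | no ¬qx = contradiction qx ¬qx
  ... | no _   | yes _  = s≤s (length-filter-mono xs)
  length-filter-< {xs = y ∷ xs} (there x∈xs) qx ¬px with P? y | Q? y
  ... | yes py | no ¬qy = contradiction (P⇒Q py) ¬qy
  ... | yes _  | yes _  = s≤s (length-filter-< x∈xs qx ¬px)
  ... | no _   | yes _  = ≤-trans (length-filter-< x∈xs qx ¬px) (n≤1+n _)
  ... | no _   | no _   = length-filter-< x∈xs qx ¬px

∣p∪⁅x⁆∣≤1+∣p∣ : ∀ {k} (p : Subset k) x → ∣ p ∪ ⁅ x ⁆ ∣ ≤ suc ∣ p ∣
∣p∪⁅x⁆∣≤1+∣p∣ (outside ∷ p) zero    rewrite ∪-identityʳ p = ≤-refl
∣p∪⁅x⁆∣≤1+∣p∣ (inside  ∷ p) zero    rewrite ∪-identityʳ p = n≤1+n _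
∣p∪⁅x⁆∣≤1+∣p∣ (outside ∷ p) (suc x) = ∣p∪⁅x⁆∣≤1+∣p∣ p x
∣p∪⁅x⁆∣≤1+∣p∣ (inside  ∷ p) (suc x) = s≤s (∣p∪⁅x⁆∣≤1+∣p∣ p x)

x∉p⇒∣p∣<∣p∪⁅x⁆∣ : ∀ {k} {p : Subset k} {x} → x ∉ p → ∣ p ∣ < ∣ p ∪ ⁅ x ⁆ ∣
x∉p⇒∣p∣<∣p∪⁅x⁆∣ {p = p} {x} x∉p = p⊂q⇒∣p∣<∣q∣ (p⊆p∪q ⁅ x ⁆ , x , q⊆p∪q p ⁅ x ⁆ (x∈⁅x⁆ x) , x∉p)

x∉p⇒∣p∣<n : ∀ {k} {p : Subset k} {x} → x ∉ p → ∣ p ∣ < k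
x∉p⇒∣p∣<n {p = p} {x} x∉p = <-≤-trans (x∉p⇒∣p∣<∣p∪⁅x⁆∣ x∉p) (∣p∣≤n (p ∪ ⁅ x ⁆))

x∈p∪⁅y⁆⇒x∈p : ∀ {k} {p : Subset k} {x y} → x ∈ p ∪ ⁅ y ⁆ → x ≢ y → x ∈ p
x∈p∪⁅y⁆⇒x∈p {p = p} {y = y} x∈p∪y x≢y with x∈p∪q⁻ p ⁅ y ⁆ x∈p∪y
... | inj₁ x∈p = x∈p
... | inj₂ x∈y = contradiction (x∈⁅y⁆⇒x≡y y x∈y) x≢y

fromList : ∀ {k} → List (Fin k) → Subset k
fromList []       = Subset.⊥
fromList (x ∷ xs) = fromList xs ∪ ⁅ x ⁆

∣fromList∣≤length : ∀ {k} (xs : List (Fin k)) → ∣ fromList xs ∣ ≤ length xs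
∣fromList∣≤length {k} []       = ≤-reflexive (∣⊥∣≡0 k)
∣fromList∣≤length     (x ∷ xs) = ≤-trans (∣p∪⁅x⁆∣≤1+∣p∣ (fromList xs) x) (s≤s (∣fromList∣≤length xs))

∈ₗ⇒∈fromList : ∀ {k} {x : Fin k} {xs} → x ∈ₗ xs → x ∈ fromList xs
∈ₗ⇒∈fromList {x = x} {_ ∷ xs} (here refl) = q⊆p∪q (fromList xs) ⁅ x ⁆ (x∈⁅x⁆ x)
∈ₗ⇒∈fromList {xs = y ∷ _} (there x∈xs)   = p⊆p∪q ⁅ y ⁆ (∈ₗ⇒∈fromList x∈xs)

m≤1+n+o∧o<p⇒m≤n+p : ∀ {m n o p} → m ≤ suc n + o → o < p → m ≤ n + p
m≤1+n+o∧o<p⇒m≤n+p {n = n} {o} m≤ o<p = ≤-trans m≤ (≤-trans (≤-reflexive (sym (+-suc n o))) (+-monoʳ-≤ n o<p))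

Vertex : Hypergraph → Set
Vertex H = Fin (n H)

VertexSet : Hypergraph → Set
VertexSet H = Subset (n H)

NonTrivialEdges : Hypergraph → Set
NonTrivialEdges H = ∀ e → e ∈ₑ edges H → 2 ≤ ∣ e ∣

module _ (H : Hypergraph) where

  spreads? : {F : FireSet (n H)} → Decidable F → Decidable (Spreads H F)
  spreads? F? v = ∃-∈? (λ e → v ∈? e ×-dec 2 ≤? ∣ e ∣ ×-dec
                               Fin.all? λ w → w ∈? e →-dec ¬? (w Fin.≟ v) →-dec F? w)
                       (edges H)

  step? : {F : FireSet (n H)} → Decidable F → ∀ u → Decidable (step H F u)
  step? F? u v = F? v ⊎-dec spreads? F? v ⊎-dec v Fin.≟ u

  run? : {F : FireSet (n H)} → Decidable F → ∀ us → Decidable (run H F us)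
  run? F? []       = F?
  run? F? (u ∷ us) = run? (step? F? u) us

  validSources? : {F : FireSet (n H)} → Decidable F → Decidable (ValidSources H F)
  validSources? F? []       = yes tt
  validSources? F? (u ∷ us) = ¬? (F? u) ×-dec validSources? (step? F? u) us

  emptyFire? : Decidable (emptyFire {n H})
  emptyFire? _ = no λ ()

  burningSequence? : Decidable (IsBurningSequence H)
  burningSequence? us = validSources? emptyFire? us ×-dec Fin.all? (run? emptyFire? us)

  independent? : Decidable (IsIndependent H)
  independent? X = map′ (λ noEdge e → All.lookup noEdge) (λ indep → All.tabulate λ {e} → indep e)
                        (All.all? (λ e → ¬? (e ⊆? X)) (edges H))

  ⊥-independent : NonTrivialEdges H → IsIndependent H Subset.⊥
  ⊥-independent nonTrivial e e∈E e⊆⊥ =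
    contradiction (≤-trans (nonTrivial e e∈E) (≤-trans (p⊆q⇒∣p∣≤∣q∣ e⊆⊥) (≤-reflexive (∣⊥∣≡0 (n H))))) λ ()

  edgesInside : VertexSet H → ℕ
  edgesInside C = length (filter (_⊆? C) (edges H))

  Closed : VertexSet H → Set
  Closed D = ∀ v → v ∉ D → ¬ Spreads H (_∈ D) v

  record LazilyReached (S C : VertexSet H) : Set where
    field
      sources⊆ : S ⊆ C
      burnt    : ∀ {v} → v ∈ C → LazyBurnt H S v
      bounded  : ∣ C ∣ ≤ ∣ S ∣ + edgesInside C

  reached-extend : ∀ {S C v} → LazilyReached S C → v ∉ C → Spreads H (_∈ C) v →
                   LazilyReached S (C ∪ ⁅ v ⁆)
  reached-extend {S} {C} {v} reached v∉C (e , e∈E , v∈e , two , others∈C) = record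
    { sources⊆ = λ x∈S → p⊆p∪q ⁅ v ⁆ (sources⊆ x∈S)
    ; burnt    = burnt′
    ; bounded  = begin
        ∣ C ∪ ⁅ v ⁆ ∣                    ≤⟨ ∣p∪⁅x⁆∣≤1+∣p∣ C v ⟩
        suc ∣ C ∣                        ≤⟨ s≤s bounded ⟩
        suc (∣ S ∣ + edgesInside C)      ≡⟨ sym (+-suc ∣ S ∣ (edgesInside C)) ⟩
        ∣ S ∣ + suc (edgesInside C)      ≤⟨ +-monoʳ-≤ ∣ S ∣ completesEdge ⟩
        ∣ S ∣ + edgesInside (C ∪ ⁅ v ⁆)  ∎
    }
    where
    open LazilyReached reached
    open ≤-Reasoning

    e⊆C∪v : e ⊆ C ∪ ⁅ v ⁆
    e⊆C∪v {w} w∈e with w Fin.≟ v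
    ... | yes refl = q⊆p∪q C ⁅ v ⁆ (x∈⁅x⁆ v)
    ... | no w≢v   = p⊆p∪q ⁅ v ⁆ (others∈C w w∈e w≢v)

    completesEdge : edgesInside C < edgesInside (C ∪ ⁅ v ⁆)
    completesEdge = length-filter-< (_⊆? C) (_⊆? (C ∪ ⁅ v ⁆)) (λ e⊆C x∈e → p⊆p∪q ⁅ v ⁆ (e⊆C x∈e))
                                    e∈E e⊆C∪v (λ e⊆C → v∉C (e⊆C v∈e))

    burnt′ : ∀ {w} → w ∈ C ∪ ⁅ v ⁆ → LazyBurnt H S w
    burnt′ {w} w∈C∪v with w Fin.≟ v
    ... | yes refl = spread e e∈E v∈e two λ x x∈e x≢v → burnt (others∈C x x∈e x≢v)
    ... | no w≢v   = burnt (x∈p∪⁅y⁆⇒x∈p w∈C∪v w≢v)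

  lazyClosure : ∀ S → Σ (VertexSet H) λ D → LazilyReached S D × Closed D
  lazyClosure S = grow (n H) S start (m≤m+n (n H) ∣ S ∣)
    where
    start : LazilyReached S S
    start = record { sources⊆ = id ; burnt = source ; bounded = m≤m+n ∣ S ∣ (edgesInside S) }

    grow : ∀ fuel C → LazilyReached S C → n H ≤ fuel + ∣ C ∣ → Σ (VertexSet H) λ D → LazilyReached S D × Closed D
    grow fuel C reached enough with Fin.any? (λ v → ¬? (v ∈? C) ×-dec spreads? (_∈? C) v)
    ... | no stuck = C , reached , λ v v∉C spreads → stuck (v , v∉C , spreads)
    grow zero       C reached enough | yes (v , v∉C , _) = contradiction enough (<⇒≱ (x∉p⇒∣p∣<n v∉C))
    grow (suc fuel) C reached enough | yes (v , v∉C , spreads) =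
      grow fuel (C ∪ ⁅ v ⁆) (reached-extend reached v∉C spreads)
           (m≤1+n+o∧o<p⇒m≤n+p enough (x∉p⇒∣p∣<∣p∪⁅x⁆∣ v∉C))

  lazyBurnt⇒∈closed : ∀ {S D} → S ⊆ D → Closed D → ∀ {v} → LazyBurnt H S v → v ∈ D
  lazyBurnt⇒∈closed S⊆D closed (source v∈S) = S⊆D v∈S
  lazyBurnt⇒∈closed {D = D} S⊆D closed {v} (spread e e∈E v∈e two burnt) with v ∈? D
  ... | yes v∈D = v∈D
  ... | no v∉D  = contradiction (e , e∈E , v∈e , two , λ w w∈e w≢v → lazyBurnt⇒∈closed S⊆D closed (burnt w w∈e w≢v))
                                (closed v v∉D)

  lazyBurningSet? : Decidable (IsLazyBurningSet H)
  lazyBurningSet? S with lazyClosure S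
  ... | D , reached , closed =
    let open LazilyReached reached in
    map′ (λ all∈D v → burnt (all∈D v)) (λ lazy v → lazyBurnt⇒∈closed sources⊆ closed (lazy v)) (Fin.all? (_∈? D))

  lazyBurningSet-size : ∀ {S} → IsLazyBurningSet H S → n H ≤ numE H + ∣ S ∣
  lazyBurningSet-size {S} lazy with lazyClosure S
  ... | D , reached , closed = begin
        n H                      ≡⟨ sym (∣⊤∣≡n (n H)) ⟩
        ∣ Subset.⊤ {n H} ∣       ≤⟨ p⊆q⇒∣p∣≤∣q∣ {p = Subset.⊤} (λ {v} _ → lazyBurnt⇒∈closed sources⊆ closed (lazy v)) ⟩
        ∣ D ∣                    ≤⟨ bounded ⟩
        ∣ S ∣ + edgesInside D    ≤⟨ +-monoʳ-≤ ∣ S ∣ (length-filter (_⊆? D) (edges H)) ⟩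
        ∣ S ∣ + numE H           ≡⟨ +-comm ∣ S ∣ (numE H) ⟩
        numE H + ∣ S ∣           ∎
    where
    open LazilyReached reached
    open ≤-Reasoning

  numV∸numE≤lazyBurningNumber : ∀ {bL} → IsLazyBurningNumber H bL → numV H ∸ numE H ≤ bL
  numV∸numE≤lazyBurningNumber ((S , lazy , refl) , _) = m≤n+o⇒m∸n≤o (numV H) (numE H) (lazyBurningSet-size lazy)

  run-∷ʳ : ∀ F us u → run H F (us ∷ʳ u) ≡ step H (run H F us) u
  run-∷ʳ F []       u = refl
  run-∷ʳ F (x ∷ us) u = run-∷ʳ (step H F x) us u

  module _ {S : VertexSet H} {F : FireSet (n H)} (F⊆burnt : ∀ {v} → F v → LazyBurnt H S v) where

    spreads⇒lazyBurnt : ∀ {v} → Spreads H F v → LazyBurnt H S v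
    spreads⇒lazyBurnt (e , e∈E , v∈e , two , others) = spread e e∈E v∈e two λ w w∈e w≢v → F⊆burnt (others w w∈e w≢v)

    step⇒lazyBurnt : ∀ {u} → u ∈ S → ∀ {v} → step H F u v → LazyBurnt H S v
    step⇒lazyBurnt u∈S (inj₁ burning)         = F⊆burnt burning
    step⇒lazyBurnt u∈S (inj₂ (inj₁ spreads)) = spreads⇒lazyBurnt spreads
    step⇒lazyBurnt u∈S (inj₂ (inj₂ refl))    = source u∈S

  run⇒lazyBurnt : ∀ {S F} → (∀ {v} → F v → LazyBurnt H S v) → ∀ us → (∀ {u} → u ∈ₗ us → u ∈ S) →
                  ∀ {v} → run H F us v → LazyBurnt H S v
  run⇒lazyBurnt F⊆burnt []       us⊆S = F⊆burnt
  run⇒lazyBurnt F⊆burnt (u ∷ us) us⊆S =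
    run⇒lazyBurnt (step⇒lazyBurnt F⊆burnt (us⊆S (here refl))) us (us⊆S ∘ there)

  allButOne⇒lazyBurningSet : NonTrivialEdges H → NoIsolated H → ∀ {S} u →
                             (∀ v → v ≢ u → LazyBurnt H S v) → IsLazyBurningSet H S
  allButOne⇒lazyBurningSet nonTrivial noIsolated u others v with v Fin.≟ u
  ... | no v≢u   = others v v≢u
  ... | yes refl = let e , e∈E , v∈e = noIsolated v in
                   spread e e∈E v∈e (nonTrivial e e∈E) λ w _ w≢v → others w w≢v

  burningSequence⇒lazyBurningSet : NonTrivialEdges H → NoIsolated H → ∀ us u →
                                   IsBurningSequence H (us ∷ʳ u) → IsLazyBurningSet H (fromList us)
  burningSequence⇒lazyBurningSet nonTrivial noIsolated us u (_ , burnsAll) =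
    allButOne⇒lazyBurningSet nonTrivial noIsolated u burntBeforeLast
    where
    burntBefore : ∀ {v} → run H emptyFire us v → LazyBurnt H (fromList us) v
    burntBefore = run⇒lazyBurnt (λ ()) us ∈ₗ⇒∈fromList

    burntBeforeLast : ∀ v → v ≢ u → LazyBurnt H (fromList us) v
    burntBeforeLast v v≢u with subst (λ F → F v) (run-∷ʳ emptyFire us u) (burnsAll v)
    ... | inj₁ burning         = burntBefore burning
    ... | inj₂ (inj₁ spreads) = spreads⇒lazyBurnt burntBefore spreads
    ... | inj₂ (inj₂ v≡u)     = contradiction v≡u v≢u

  lazyBurningNumber<burningNumber : NonTrivialEdges H → NoIsolated H → ∀ {bL b} →
                                    IsLazyBurningNumber H bL → IsBurningNumber H b → bL < b
  lazyBurningNumber<burningNumber nonTrivial noIsolated {bL} (_ , minimal) ((us , burning , refl) , _)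
    with initLast us
  ... | []       = contradiction (proj₂ burning (fromℕ< (nonempty H))) λ ()
  ... | xs ∷ʳ′ u = begin-strict
        bL                   ≤⟨ minimal (fromList xs) (burningSequence⇒lazyBurningSet nonTrivial noIsolated xs u burning) ⟩
        ∣ fromList xs ∣      ≤⟨ ∣fromList∣≤length xs ⟩
        length xs            <⟨ m<m+n (length xs) z<s ⟩
        length xs + 1        ≡⟨ sym (length-++ xs) ⟩
        length (xs ∷ʳ u)     ∎
    where open ≤-Reasoning

  independent-extend : NonTrivialEdges H → ∀ {F I u} → IsIndependent H I → (∀ {v} → v ∈ I → F v) →
                       ¬ Spreads H F u → IsIndependent H (I ∪ ⁅ u ⁆)
  independent-extend nonTrivial {u = u} indep I⊆F quiet e e∈E e⊆I∪u with u ∈? e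
  ... | no u∉e  = indep e e∈E λ w∈e → x∈p∪⁅y⁆⇒x∈p (e⊆I∪u w∈e) λ { refl → u∉e w∈e }
  ... | yes u∈e = quiet (e , e∈E , u∈e , nonTrivial e e∈E , λ w w∈e w≢u → I⊆F (x∈p∪⁅y⁆⇒x∈p (e⊆I∪u w∈e) w≢u))

  lastRound : ∀ {F} → (∀ v → F v ⊎ Spreads H F v) → ∀ u v → step H F u v
  lastRound imminent u v = Sum.map₂ inj₁ (imminent v)

  GreedyRun : FireSet (n H) → VertexSet H → Set
  GreedyRun F I = Σ (List (Vertex H)) λ us → ValidSources H F us × (∀ v → run H F us v) ×
                  Σ (VertexSet H) λ J → IsIndependent H J × ∣ I ∣ + length us ≤ suc ∣ J ∣

  greedy : NonTrivialEdges H → ∀ fuel {F} → Decidable F → ∀ I → (∀ {v} → v ∈ I → F v) →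
           IsIndependent H I → n H ≤ fuel + ∣ I ∣ → GreedyRun F I
  greedy nonTrivial fuel {F} F? I I⊆F indep enough =
    case Fin.any? (λ v → ¬? (F? v ⊎-dec spreads? F? v)) of λ where
      (yes (u , quiet)) → continue fuel enough u (quiet ∘ inj₁) (quiet ∘ inj₂)
      (no noQuiet)      → finish λ v → decidable-stable (F? v ⊎-dec spreads? F? v) λ quiet → noQuiet (v , quiet)
    where
    finish : (∀ v → F v ⊎ Spreads H F v) → GreedyRun F I
    finish imminent with Fin.any? (λ v → ¬? (F? v))
    ... | no noneUnburnt   = [] , tt , (λ v → decidable-stable (F? v) λ ¬burning → noneUnburnt (v , ¬burning)) ,
                             I , indep , ≤-trans (≤-reflexive (+-comm ∣ I ∣ 0)) (n≤1+n ∣ I ∣)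
    ... | yes (u , unburnt) = u ∷ [] , (unburnt , tt) , lastRound imminent u , I , indep , ≤-reflexive (+-comm ∣ I ∣ 1)

    larger : ∀ {u} → ¬ F u → ∣ I ∣ < ∣ I ∪ ⁅ u ⁆ ∣
    larger unburnt = x∉p⇒∣p∣<∣p∪⁅x⁆∣ (unburnt ∘ I⊆F)

    I∪u⊆step : ∀ u {v} → v ∈ I ∪ ⁅ u ⁆ → step H F u v
    I∪u⊆step u {v} v∈I∪u with v Fin.≟ u
    ... | yes v≡u = inj₂ (inj₂ v≡u)
    ... | no v≢u  = inj₁ (I⊆F (x∈p∪⁅y⁆⇒x∈p v∈I∪u v≢u))

    continue : ∀ fuel → n H ≤ fuel + ∣ I ∣ → ∀ u → ¬ F u → ¬ Spreads H F u → GreedyRun F I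
    continue zero enough u unburnt quiet = contradiction enough (<⇒≱ (x∉p⇒∣p∣<n (unburnt ∘ I⊆F)))
    continue (suc fuel) enough u unburnt quiet
      with greedy nonTrivial fuel (step? F? u) (I ∪ ⁅ u ⁆) (I∪u⊆step u)
                  (independent-extend nonTrivial indep I⊆F quiet) (m≤1+n+o∧o<p⇒m≤n+p enough (larger unburnt))
    ... | us , valid , burnsAll , J , indepJ , bound =
      u ∷ us , (unburnt , valid) , burnsAll , J , indepJ ,
      ≤-trans (≤-reflexive (+-suc ∣ I ∣ (length us))) (≤-trans (+-monoˡ-≤ (length us) (larger unburnt)) bound)

  greedyBurning : NonTrivialEdges H → Σ (List (Vertex H)) λ us → IsBurningSequence H us ×
                  Σ (VertexSet H) λ J → IsIndependent H J × length us ≤ suc ∣ J ∣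
  greedyBurning nonTrivial
    with greedy nonTrivial (n H) emptyFire? Subset.⊥ ∉⊥ (⊥-independent nonTrivial) (m≤m+n (n H) _)
  ... | us , valid , burnsAll , J , indepJ , bound =
    us , (valid , burnsAll) , J , indepJ , subst (λ k → k + length us ≤ suc ∣ J ∣) (∣⊥∣≡0 (n H)) bound

  burningNumber≤independenceNumber+1 : NonTrivialEdges H → ∀ {b a} →
                                       IsBurningNumber H b → IsIndependenceNumber H a → b ≤ a + 1
  burningNumber≤independenceNumber+1 nonTrivial {b} {a} (_ , minimal) (_ , maximal)
    with greedyBurning nonTrivial
  ... | us , burning , J , indepJ , bound = begin
        b           ≤⟨ minimal us burning ⟩
        length us   ≤⟨ bound ⟩
        suc ∣ J ∣   ≤⟨ s≤s (maximal J indepJ) ⟩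
        suc a       ≡⟨ +-comm 1 a ⟩
        a + 1       ∎
    where open ≤-Reasoning

  lazyBurningNumber-exists : Σ ℕ (IsLazyBurningNumber H)
  lazyBurningNumber-exists =
    least-exists (λ m → anySubset? λ S → lazyBurningSet? S ×-dec ∣ S ∣ ≟ m) Subset.⊤ (λ _ → source ∈⊤)

  burningNumber-exists : NonTrivialEdges H → Σ ℕ (IsBurningNumber H)
  burningNumber-exists nonTrivial =
    let us , burning , _ = greedyBurning nonTrivial in
    least-exists (∃-ofLength? burningSequence?) us burning

  independenceNumber-exists : NonTrivialEdges H → Σ ℕ (IsIndependenceNumber H)
  independenceNumber-exists nonTrivial =
    greatest-exists (λ m → anySubset? λ X → independent? X ×-dec ∣ X ∣ ≟ m) (n H) (λ X _ → ∣p∣≤n X)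
                    Subset.⊥ (⊥-independent nonTrivial)

mainTheorem6 : (H : Hypergraph) → IsSimple H → NoIsolated H →
    Σ ℕ λ bL → Σ ℕ λ b → Σ ℕ λ a →
      IsLazyBurningNumber H bL × IsBurningNumber H b × IsIndependenceNumber H a ×
      (numV H ∸ numE H ≤ bL) × (bL < b) × (b ≤ a + 1)
mainTheorem6 H (_ , nonTrivial) noIsolated =
  let bL , lazyBurningNumber  = lazyBurningNumber-exists H
      b  , burningNumber      = burningNumber-exists H nonTrivial
      a  , independenceNumber = independenceNumber-exists H nonTrivial
  in  bL , b , a , lazyBurningNumber , burningNumber , independenceNumber ,
      numV∸numE≤lazyBurningNumber H lazyBurningNumber ,
      lazyBurningNumber<burningNumber H nonTrivial noIsolated lazyBurningNumber burningNumber ,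
      burningNumber≤independenceNumber+1 H nonTrivial burningNumber independenceNumber
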